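{- Let $a,n$ be positive integers with $1<a<n$ and $\gcd(a,n)=1$, and assume that both $a$ and $\lceil n/a\rceil$ are even. Then $$V(a,n)\le 0.75\, a\left\lceil\frac{n}{a}\right\rceil.$$
   Context: $P_{a,n}=\{t_1(1,0)+t_2(a,n) : 0\le t_1,t_2\le 1\}$. A lattice point $(u_1,u_2)\in\mathbb{Z}^2$ is visible if $\gcd(u_1,u_2)=1$, and $V(a,n)$ is the number of visible lattice points in the interior of $P_{a,n}$. -}

module Defs where

open import Data.Nat using (ℕ; zero; suc; _+_; _*_; _∸_; _<_; _<?_; _/_)
open import Data.Nat.GCD using (gcd)
open import Data.Nat.Properties using (_≟_)
open import Data.List using (List; upTo; length; filter; cartesianProduct)
open import Relation.Binary.PropositionalEquality using (_≡_)
open import Data.Product using (_×_; _,_; proj₁; proj₂)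
open import Relation.Nullary using (Dec)
open import Relation.Nullary.Decidable using (_×-dec_)

-- Interior of P_{a,n} = { t1 (1,0) + t2 (a,n) : 0 ≤ t1,t2 ≤ 1 }.
-- (u1,u2) = t1(1,0)+t2(a,n) gives t2 = u2/n, t1 = u1 - a*u2/n, so for n > 0
-- (u1,u2) is interior iff 0 < u2 < n and a*u2 < n*u1 < a*u2 + n.
-- Such points automatically have u1 ≥ 1, u2 ≥ 1, so ℕ coordinates suffice.
InInterior : ℕ → ℕ → ℕ × ℕ → Set
InInterior a n (u1 , u2) = (0 < u2 × u2 < n) × (a * u2 < n * u1 × n * u1 < a * u2 + n)

inInterior? : (a n : ℕ) (p : ℕ × ℕ) → Dec (InInterior a n p)
inInterior? a n (u1 , u2) =
  ((0 <? u2) ×-dec (u2 <? n)) ×-dec ((a * u2 <? n * u1) ×-dec (n * u1 <? a * u2 + n))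

Visible : ℕ × ℕ → Set
Visible (u1 , u2) = gcd u1 u2 ≡ 1

visible? : (p : ℕ × ℕ) → Dec (Visible p)
visible? (u1 , u2) = gcd u1 u2 ≟ 1

-- Candidate box: 0 ≤ u1 ≤ a, 0 ≤ u2 ≤ n (contains every interior point since
-- u1 < a*u2/n + 1 < a + 1 and u2 < n).
box : ℕ → ℕ → List (ℕ × ℕ)
box a n = cartesianProduct (upTo (suc a)) (upTo (suc n))

V : ℕ → ℕ → ℕ
V a n = length (filter (λ p → inInterior? a n p ×-dec visible? p) (box a n))

ceilDiv : (n a : ℕ) → ℕ
ceilDiv n zero = 0
ceilDiv n (suc k) = (n + k) / suc k

-- Fix the first coordinate u₁ = j.  The interior points of P_{a,n} in that column satisfy
-- a u₂ < n j < a u₂ + n, so their second coordinates lie in an open interval of length n/a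
-- and there are at most m = ⌈n/a⌉ of them.  When j is even a visible point needs u₂ odd, so
-- no two of them are adjacent and there are at most m/2.  Column 0 is empty, and among the
-- columns 1, …, a (a even) half are odd and half are even, whence
-- V(a,n) ≤ (a/2)(m + m/2) = (3/4) a m.
module Submission where

open import Defs
open import Level using (0ℓ)
open import Data.Nat using (ℕ; zero; suc; _+_; _*_; _%_; _<_; _≤_; z≤n; s≤s; s<s⁻¹; s≤s⁻¹; NonZero)
open import Data.Nat.Properties
open import Data.Nat.DivMod using (m≡m%n+[m/n]*n; m%n<n)
open import Data.Nat.Divisibility using (_∣_; divides)
open import Data.Nat.GCD using (gcd)
open import Data.Nat.Coprimality using (gcd≡1⇒coprime)
open import Data.Nat.Solver using (module +-*-Solver)
open import Data.List using (List; length; filter; map; _++_; applyUpTo; cartesianProduct)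
open import Data.List.Properties using (length-++; filter-++; map-applyUpTo)
open import Data.Product using (_×_; _,_; proj₁; proj₂; ∃-syntax)
open import Data.Sum using (_⊎_; inj₁; inj₂)
open import Relation.Nullary using (Dec; yes; no; ¬_; contradiction)
open import Relation.Nullary.Decidable using (_×-dec_)
open import Relation.Unary using (Pred; Decidable)
open import Function using (_∘_; id)
open import Relation.Binary.PropositionalEquality
  using (_≡_; refl; sym; cong; cong₂; subst; subst₂; module ≡-Reasoning)

Σ< : ℕ → (ℕ → ℕ) → ℕ
Σ< zero    r = 0
Σ< (suc l) r = r 0 + Σ< l (λ i → r (suc i))

Σ<-+ : ∀ j l (r : ℕ → ℕ) → Σ< (j + l) r ≡ Σ< j r + Σ< l (λ i → r (j + i))
Σ<-+ zero    l r = refl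
Σ<-+ (suc j) l r = begin
  r 0 + Σ< (j + l) (λ i → r (suc i))                          ≡⟨ cong (r 0 +_) (Σ<-+ j l (λ i → r (suc i))) ⟩
  r 0 + (Σ< j (λ i → r (suc i)) + Σ< l (λ i → r (suc j + i))) ≡⟨ sym (+-assoc (r 0) _ _) ⟩
  r 0 + Σ< j (λ i → r (suc i)) + Σ< l (λ i → r (suc j + i))   ∎
  where open ≡-Reasoning

Σ<-monoˡ-≤ : ∀ {l l′} (r : ℕ → ℕ) → l ≤ l′ → Σ< l r ≤ Σ< l′ r
Σ<-monoˡ-≤ r z≤n     = z≤n
Σ<-monoˡ-≤ r (s≤s p) = +-monoʳ-≤ (r 0) (Σ<-monoˡ-≤ (λ i → r (suc i)) p)

Σ<-alternating : ∀ c {A B} (r : ℕ → ℕ) →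
  (∀ i → r (i * 2) ≤ A) → (∀ i → r (suc (i * 2)) ≤ B) → Σ< (c * 2) r ≤ c * (A + B)
Σ<-alternating zero    r even odd = z≤n
Σ<-alternating (suc c) {A} {B} r even odd = begin
  r 0 + (r 1 + Σ< (c * 2) (λ i → r (suc (suc i))))
    ≤⟨ +-mono-≤ (even 0) (+-mono-≤ (odd 0)
         (Σ<-alternating c (λ i → r (suc (suc i))) (λ i → even (suc i)) (λ i → odd (suc i)))) ⟩
  A + (B + c * (A + B))  ≡⟨ sym (+-assoc A B _) ⟩
  A + B + c * (A + B)    ∎
  where open ≤-Reasoning

indicator : {A : Set} → Dec A → ℕ
indicator (yes _) = 1
indicator (no _)  = 0

count : {P : Pred ℕ 0ℓ} → Decidable P → ℕ → ℕ
count P? l = Σ< l (λ i → indicator (P? i))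

count≤ : ∀ {P} (P? : Decidable P) l → count P? l ≤ l
count≤ P? zero = z≤n
count≤ P? (suc l) with P? 0
... | yes _ = s≤s (count≤ (λ i → P? (suc i)) l)
... | no _  = m≤n⇒m≤1+n (count≤ (λ i → P? (suc i)) l)

count-none : ∀ {P} (P? : Decidable P) l → (∀ i → ¬ P i) → count P? l ≡ 0
count-none P? zero    none = refl
count-none P? (suc l) none with P? 0
... | yes p = contradiction p (none 0)
... | no _  = count-none (λ i → P? (suc i)) l (λ i → none (suc i))

count-≤-vanishingBeyond : ∀ {P} (P? : Decidable P) m l →
  (∀ i → ¬ P (m + i)) → count P? l ≤ count P? m
count-≤-vanishingBeyond P? m l none = begin
  count P? l                                  ≤⟨ Σ<-monoˡ-≤ _ (m≤n+m l m) ⟩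
  count P? (m + l)                            ≡⟨ Σ<-+ m l _ ⟩
  count P? m + count (λ i → P? (m + i)) l     ≡⟨ cong (count P? m +_) (count-none _ l none) ⟩
  count P? m + 0                              ≡⟨ +-identityʳ _ ⟩
  count P? m                                  ∎
  where open ≤-Reasoning

WidthAtMost : ℕ → Pred ℕ 0ℓ → Set
WidthAtMost m P = ∀ {x y} → P x → P y → y < x + m

count-widthAtMost : ∀ {P} (P? : Decidable P) m l → WidthAtMost m P →
  ∃[ s ] count P? l ≤ count (λ i → P? (s + i)) m
count-widthAtMost P? m zero    width = 0 , z≤n
-- Abstracting the bound together with P? 0 lets it be used at the reduced goal of the yes-case.
count-widthAtMost P? m (suc l) width with P? 0 | count-≤-vanishingBeyond P? m (suc l)
... | yes p₀ | bound = 0 , bound (λ i pᵢ → m+n≮m m i (width p₀ pᵢ))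
... | no _   | _ =
  let s , bound = count-widthAtMost (λ i → P? (suc i)) m l (λ p q → s<s⁻¹ (width p q))
  in  suc s , bound

Isolated : Pred ℕ 0ℓ → Set
Isolated P = ∀ {x} → P x → ¬ P (suc x)

count-isolated : ∀ {P} (P? : Decidable P) h → Isolated P → count P? (h * 2) ≤ h
count-isolated     P? zero    isolated = z≤n
count-isolated {P} P? (suc h) isolated = begin
  indicator (P? 0) + (indicator (P? 1) + count (λ i → P? (2 + i)) (h * 2))
    ≡⟨ sym (+-assoc (indicator (P? 0)) _ _) ⟩
  indicator (P? 0) + indicator (P? 1) + count (λ i → P? (2 + i)) (h * 2)
    ≤⟨ +-mono-≤ (adjacent (P? 0) (P? 1)) (count-isolated _ h isolated) ⟩
  1 + h ∎
  where
  open ≤-Reasoning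
  adjacent : (d₀ : Dec (P 0)) (d₁ : Dec (P 1)) → indicator d₀ + indicator d₁ ≤ 1
  adjacent (yes p₀) (yes p₁) = contradiction p₁ (isolated p₀)
  adjacent (yes _)  (no _)   = s≤s z≤n
  adjacent (no _)   (yes _)  = s≤s z≤n
  adjacent (no _)   (no _)   = z≤n

isolated-shift : ∀ {P : Pred ℕ 0ℓ} s → Isolated P → Isolated (λ i → P (s + i))
isolated-shift {P} s isolated {x} p q = isolated p (subst P (+-suc s x) q)

length-filter-applyUpTo : ∀ {A : Set} {P : Pred A 0ℓ} (P? : Decidable P) (f : ℕ → A) l →
  length (filter P? (applyUpTo f l)) ≡ count (λ i → P? (f i)) l
length-filter-applyUpTo P? f zero = refl
length-filter-applyUpTo P? f (suc l) with P? (f 0)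
... | yes _ = cong suc (length-filter-applyUpTo P? (λ i → f (suc i)) l)
... | no _  = length-filter-applyUpTo P? (λ i → f (suc i)) l

length-filter-cartesianProduct : ∀ {A B : Set} {P : Pred (A × B) 0ℓ} (P? : Decidable P)
  (f : ℕ → A) (g : ℕ → B) k l →
  length (filter P? (cartesianProduct (applyUpTo f k) (applyUpTo g l)))
    ≡ Σ< k (λ i → count (λ j → P? (f i , g j)) l)
length-filter-cartesianProduct P? f g zero    l = refl
length-filter-cartesianProduct {A} {B} P? f g (suc k) l = begin
  length (filter P? (column ++ rest))              ≡⟨ cong length (filter-++ P? column rest) ⟩
  length (filter P? column ++ filter P? rest)      ≡⟨ length-++ (filter P? column) ⟩
  length (filter P? column) + length (filter P? rest)
    ≡⟨ cong₂ _+_ column-count (length-filter-cartesianProduct P? (λ i → f (suc i)) g k l) ⟩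
  count (λ j → P? (f 0 , g j)) l + Σ< k (λ i → count (λ j → P? (f (suc i) , g j)) l) ∎
  where
  open ≡-Reasoning
  column rest : List (A × B)
  column = map (f 0 ,_) (applyUpTo g l)
  rest   = cartesianProduct (applyUpTo (λ i → f (suc i)) k) (applyUpTo g l)
  column-count : length (filter P? column) ≡ count (λ j → P? (f 0 , g j)) l
  column-count = begin
    length (filter P? column)                            ≡⟨ cong (length ∘ filter P?) (map-applyUpTo g (f 0 ,_) l) ⟩
    length (filter P? (applyUpTo (λ j → f 0 , g j) l))  ≡⟨ length-filter-applyUpTo P? _ l ⟩
    count (λ j → P? (f 0 , g j)) l                       ∎

n≤*ceilDiv : ∀ n a .{{_ : NonZero a}} → n ≤ a * ceilDiv n a
n≤*ceilDiv n a@(suc k) = +-cancelʳ-≤ k n (a * q) (begin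
  n + k                    ≡⟨ m≡m%n+[m/n]*n (n + k) a ⟩
  (n + k) % a + q * a      ≤⟨ +-monoˡ-≤ (q * a) (s≤s⁻¹ (m%n<n (n + k) a)) ⟩
  k + q * a                ≡⟨ +-comm k (q * a) ⟩
  q * a + k                ≡⟨ cong (_+ k) (*-comm q a) ⟩
  a * q + k                ∎)
  where
  open ≤-Reasoning
  q : ℕ
  q = ceilDiv n a

2∣n⊎2∣1+n : ∀ n → 2 ∣ n ⊎ 2 ∣ suc n
2∣n⊎2∣1+n zero = inj₁ (divides 0 refl)
2∣n⊎2∣1+n (suc n) with 2∣n⊎2∣1+n n
... | inj₁ (divides q n≡q*2) = inj₂ (divides (suc q) (cong (suc ∘ suc) n≡q*2))
... | inj₂ 2∣1+n             = inj₁ 2∣1+n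

visible-evenColumn-isolated : ∀ {j} → 2 ∣ j → Isolated (λ u₂ → Visible (j , u₂))
visible-evenColumn-isolated {j} 2∣j {x} visible-x visible-1+x with 2∣n⊎2∣1+n x
... | inj₁ 2∣x   = contradiction (gcd≡1⇒coprime visible-x (2∣j , 2∣x)) λ ()
... | inj₂ 2∣1+x = contradiction (gcd≡1⇒coprime visible-1+x (2∣j , 2∣1+x)) λ ()

module _ (a n : ℕ) where

  interior-column-zero : ∀ {y} → ¬ InInterior a n (0 , y)
  interior-column-zero {y} (_ , ay<n*0 , _) = n≮0 (subst (a * y <_) (*-zeroʳ n) ay<n*0)

  interior-column-widthAtMost : ∀ {m} j → n ≤ a * m → WidthAtMost m (λ u₂ → InInterior a n (j , u₂))
  interior-column-widthAtMost {m} j n≤am {x} {y} (_ , _ , nj<ax+n) (_ , ay<nj , _) =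
    *-cancelˡ-< a y (x + m) (begin-strict
      a * y          <⟨ ay<nj ⟩
      n * j          <⟨ nj<ax+n ⟩
      a * x + n      ≤⟨ +-monoʳ-≤ (a * x) n≤am ⟩
      a * x + a * m  ≡⟨ sym (*-distribˡ-+ a x m) ⟩
      a * (x + m)    ∎)
    where open ≤-Reasoning

  VisibleInterior : Pred (ℕ × ℕ) 0ℓ
  VisibleInterior p = InInterior a n p × Visible p

  visibleInterior? : Decidable VisibleInterior
  visibleInterior? p = inInterior? a n p ×-dec visible? p

  Column : ℕ → Pred ℕ 0ℓ
  Column j u₂ = VisibleInterior (j , u₂)

  column? : ∀ j → Decidable (Column j)
  column? j u₂ = visibleInterior? (j , u₂)

  columnCount : ℕ → ℕ
  columnCount j = count (column? j) (suc n)

  V≡Σ<columnCount : V a n ≡ Σ< (suc a) columnCount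
  V≡Σ<columnCount = length-filter-cartesianProduct visibleInterior? id id (suc a) (suc n)

  columnCount-zero : columnCount 0 ≡ 0
  columnCount-zero = count-none (column? 0) (suc n) (λ _ → interior-column-zero ∘ proj₁)

  column-widthAtMost : ∀ {m} j → n ≤ a * m → WidthAtMost m (Column j)
  column-widthAtMost j n≤am (interior-x , _) (interior-y , _) =
    interior-column-widthAtMost j n≤am interior-x interior-y

  columnCount≤ : ∀ {m} j → n ≤ a * m → columnCount j ≤ m
  columnCount≤ {m} j n≤am =
    let _ , bound = count-widthAtMost (column? j) m (suc n) (column-widthAtMost j n≤am)
    in  ≤-trans bound (count≤ _ m)

  evenColumnCount≤ : ∀ {h} j → n ≤ a * (h * 2) → 2 ∣ j → columnCount j ≤ h
  evenColumnCount≤ {h} j n≤am 2∣j =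
    let s , bound = count-widthAtMost (column? j) (h * 2) (suc n) (column-widthAtMost j n≤am)
    in  ≤-trans bound (count-isolated (λ i → column? j (s + i)) h (isolated-shift {Column j} s isolated))
    where
    isolated : Isolated (Column j)
    isolated (_ , visible-x) (_ , visible-1+x) = visible-evenColumn-isolated 2∣j visible-x visible-1+x

V≤c*[h*2+h] : ∀ c h n → n ≤ c * 2 * (h * 2) → V (c * 2) n ≤ c * (h * 2 + h)
V≤c*[h*2+h] c h n n≤am = begin
  V a n                                                 ≡⟨ V≡Σ<columnCount a n ⟩
  columnCount a n 0 + Σ< a (columnCount a n ∘ suc)      ≡⟨ cong (_+ Σ< a (columnCount a n ∘ suc)) (columnCount-zero a n) ⟩
  Σ< a (columnCount a n ∘ suc)
    ≤⟨ Σ<-alternating c _ (λ i → columnCount≤ a n (suc (i * 2)) n≤am)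
                          (λ i → evenColumnCount≤ a n (suc i * 2) n≤am (divides (suc i) refl)) ⟩
  c * (h * 2 + h)                                       ∎
  where
  open ≤-Reasoning
  a : ℕ
  a = c * 2

proposition10 : (a n : ℕ) → 1 < a → a < n → gcd a n ≡ 1 →
    2 ∣ a → 2 ∣ ceilDiv n a →
    4 * V a n ≤ 3 * (a * ceilDiv n a)
proposition10 zero      n () _ _ _ _
proposition10 a@(suc _) n _ _ _ (divides c a≡c*2) (divides h m≡h*2) = begin
  4 * V a n                  ≡⟨ cong (λ a → 4 * V a n) a≡c*2 ⟩
  4 * V (c * 2) n            ≤⟨ *-monoʳ-≤ 4 (V≤c*[h*2+h] c h n n≤am) ⟩
  4 * (c * (h * 2 + h))      ≡⟨ three-quarters c h ⟩
  3 * (c * 2 * (h * 2))      ≡⟨ cong₂ (λ a m → 3 * (a * m)) (sym a≡c*2) (sym m≡h*2) ⟩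
  3 * (a * ceilDiv n a)      ∎
  where
  open ≤-Reasoning
  n≤am : n ≤ c * 2 * (h * 2)
  n≤am = subst₂ (λ a m → n ≤ a * m) a≡c*2 m≡h*2 (n≤*ceilDiv n a)
  three-quarters : ∀ c h → 4 * (c * (h * 2 + h)) ≡ 3 * (c * 2 * (h * 2))
  three-quarters = solve 2 (λ c h → con 4 :* (c :* (h :* con 2 :+ h)) := con 3 :* (c :* con 2 :* (h :* con 2))) refl
    where open +-*-Solver
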